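{- Let $p$ be a permutation of length $k$ with doubling number $t$. Then the length of the shortest alternating permutation that contains $p$ is $k+t$.
   Context: A permutation $w\in S_n$ is alternating if $w_1<w_2>w_3<w_4>\cdots$. A permutation contains a pattern $p$ if some subsequence of it is order-isomorphic to $p$. For $p=p_1\cdots p_k$, set $p_0=\infty$ and define the doubling set $d(p)=\{i\in[k-1]: p_{i-1}>p_i>p_{i+1}\text{ or }p_{i-1}<p_i<p_{i+1}\}$; the doubling number of $p$ is $|d(p)|$. -}

module Defs where

open import Data.Nat using (ℕ; zero; suc; _+_; _∸_; _<_; _<?_)
open import Data.Nat.Properties using ()
open import Data.Fin using (Fin; toℕ; fromℕ<)
open import Data.Fin.Permutation using (Permutation′; _⟨$⟩ʳ_)
open import Data.List using (List; length; filter; upTo)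
open import Data.Product using (Σ; _×_; _,_)
open import Data.Sum using (_⊎_)
open import Relation.Nullary using (Dec; yes; no)
open import Relation.Nullary.Decidable using (_×-dec_; _⊎-dec_)
open import Function.Bundles using (_⇔_)
open import Relation.Binary.PropositionalEquality using (_≡_)

-- Permutations of length n are bijections of Fin n (positions 0..n-1,
-- values 0..n-1).  Position i (0-based) corresponds to w_{i+1}.

-- one-line value of a permutation at a natural-number position (0 if out of range)
val : ∀ {k} → Permutation′ k → ℕ → ℕ
val {k} p m with m <? k
... | yes m<k = toℕ (p ⟨$⟩ʳ fromℕ< m<k)
... | no _ = 0

-- alternating: w_1 < w_2 > w_3 < w_4 > ...  (0-based: ascent at even
-- positions, descent at odd positions)
data EvenN : ℕ → Set
data OddN : ℕ → Set
data EvenN where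
  ev0 : EvenN zero
  evS : ∀ {n} → OddN n → EvenN (suc n)
data OddN where
  odS : ∀ {n} → EvenN n → OddN (suc n)

Alternating : ∀ {n} → Permutation′ n → Set
Alternating {n} w = ∀ (i : ℕ) → suc i < n →
  (EvenN i → val w i < val w (suc i)) × (OddN i → val w (suc i) < val w i)

Contains : ∀ {n k} → Permutation′ n → Permutation′ k → Set
Contains {n} {k} w p = Σ (Fin k → Fin n) λ f →
  (∀ i j → toℕ i < toℕ j → toℕ (f i) < toℕ (f j)) ×
  (∀ i j → (toℕ (p ⟨$⟩ʳ i) < toℕ (p ⟨$⟩ʳ j)) ⇔ (toℕ (w ⟨$⟩ʳ f i) < toℕ (w ⟨$⟩ʳ f j)))

-- Doubling condition at 1-based index i = j+1 ∈ [k-1] (so j < k-1),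
-- with p_0 = ∞:  j = 0: p_1 > p_2 (since ∞ > p_1 always);
-- j = suc j': p_{j'} > p_j > p_{j+1}  or  p_{j'} < p_j < p_{j+1} (0-based values).
DoublingAt : ∀ {k} → Permutation′ k → ℕ → Set
DoublingAt p zero = val p 1 < val p 0
DoublingAt p (suc j) =
  (val p (suc j) < val p j × val p (suc (suc j)) < val p (suc j)) ⊎
  (val p j < val p (suc j) × val p (suc j) < val p (suc (suc j)))

doublingAt? : ∀ {k} (p : Permutation′ k) (j : ℕ) → Dec (DoublingAt p j)
doublingAt? p zero = val p 1 <? val p 0
doublingAt? p (suc j) =
  ((val p (suc j) <? val p j) ×-dec (val p (suc (suc j)) <? val p (suc j))) ⊎-dec
  ((val p j <? val p (suc j)) ×-dec (val p (suc j) <? val p (suc (suc j))))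

doublingSet : ∀ {k} → Permutation′ k → List ℕ
doublingSet {k} p = filter (doublingAt? p) (upTo (k ∸ 1))

doublingNumber : ∀ {k} → Permutation′ k → ℕ
doublingNumber p = length (doublingSet p)

module Submission where

open import Defs
open import Data.Nat using (ℕ; _+_; _≤_)
open import Data.Product using (Σ; _×_)
open import Data.Fin.Permutation using (Permutation′)

open import Data.Nat using (zero; suc; _*_; _∸_; _<_; z≤n; s≤s; s≤s⁻¹; _<?_; _<ᵇ_; _≤ᵇ_)
open import Data.Nat.Properties
open import Data.Nat.Tactic.RingSolver using (solve-∀)
open import Data.Bool using (Bool; true; false; not; _xor_; if_then_else_; T)
open import Data.Bool.Properties using (T-≡; xor-same; ¬-not; not-involutive)
open import Data.Fin using (Fin; toℕ; fromℕ<; punchOut)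
import Data.Fin.Properties as Fin
import Data.Fin.Permutation as Perm
open import Data.Fin.Permutation using (_⟨$⟩ʳ_; _⟨$⟩ˡ_; inverseˡ; permutation)
open import Data.Fin.Subset using (Subset; _∈_; _⊂_; ⊤; ∣_∣)
open import Data.Fin.Subset.Properties using (∈⊤; ∣⊤∣≡n; p⊂q⇒∣p∣<∣q∣)
open import Data.Vec using (tabulate)
open import Data.Vec.Properties using (lookup∘tabulate; []=⇒lookup; lookup⇒[]=)
open import Data.List using (List; []; _∷_; _++_; [_]; length; filter; upTo)
open import Data.List.Properties using (length-++; ++-assoc; filter-++; upTo-∷ʳ)
open import Data.Product using (_,_; proj₁; proj₂)
open import Data.Sum using (_⊎_; inj₁; inj₂)
open import Data.Unit using (tt) renaming (⊤ to Unit)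
open import Data.Empty using (⊥-elim)
open import Function using (_∘_)
open import Function.Bundles using (Equivalence; _⇔_; mk⇔)
open import Function.Definitions using (Injective)
open import Relation.Binary.Definitions using (tri<; tri≈; tri>)
open import Relation.Nullary using (Dec; does; yes; no)
open import Relation.Binary.PropositionalEquality
  using (_≡_; _≢_; refl; sym; trans; cong; cong₂; subst; subst₂; module ≡-Reasoning)

-- Say p enters p_j by an ascent (up j) when p_{j-1} < p_j, with p_{-1} = ∞.  Then p_j is a
-- doubling entry exactly when p enters and leaves p_j in the same direction (doubling⇔).
--
-- Write p_j as 3·p_j + 1 and follow each doubling entry by a
-- partner just below or above it, so that the word turns around between the two.  Tracking
-- only the direction of the next move (Zigzag), the word alternates; it has k + t entries,
-- and standardising it (ranking its values) yields an alternating permutation in which the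
-- entries 3·p_j + 1 form an occurrence of p.
--
-- If p_j is matched at position F j of an alternating w, then
-- j + (doublings before p_j) + (1 if w enters F j against p's direction) ≤ F j.  Passing from
-- j to j + 1 is a finite check (gap): adjacent positions force w to move as p does, and a
-- larger gap pays for the doubling and a new mismatch.  At j = k - 1 this gives k + t ≤ n.

Step : Bool → ℕ → ℕ → Set
Step true  a b = a < b
Step false a b = b < a

step-unique : ∀ {u v a b} → Step u a b → Step v a b → u ≡ v
step-unique {true}  {true}  _ _ = refl
step-unique {true}  {false} s t = ⊥-elim (<-asym s t)
step-unique {false} {true}  s t = ⊥-elim (<-asym s t)
step-unique {false} {false} _ _ = refl

step-<ᵇ : ∀ {a b} → a ≢ b → Step (a <ᵇ b) a b
step-<ᵇ {a} {b} a≢b with a <ᵇ b in eq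
... | true  = <ᵇ⇒< a b (Equivalence.from T-≡ eq)
... | false = ≤∧≢⇒< (≮⇒≥ λ lt → subst T eq (<⇒<ᵇ lt)) (a≢b ∘ sym)

same-direction : ∀ u {a b c} → Step u a b → Step u b c →
  (Step false a b × Step false b c) ⊎ (Step true a b × Step true b c)
same-direction false s t = inj₁ (s , t)
same-direction true  s t = inj₂ (s , t)

Zigzag : Bool → ℕ → List ℕ → Set
Zigzag u a []       = Unit
Zigzag u a (x ∷ xs) = Step u a x × Zigzag (not u) x xs

-- The i-th entry of a list (0 beyond its end), matching the convention of val.
nth : List ℕ → ℕ → ℕ
nth []       _       = 0
nth (x ∷ xs) zero    = x
nth (x ∷ xs) (suc i) = nth xs i

entry : ∀ xs (y : ℕ) ys → length xs < length (xs ++ y ∷ ys) × nth (xs ++ y ∷ ys) (length xs) ≡ y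
entry []       y ys = s≤s z≤n , refl
entry (x ∷ xs) y ys = let (bound , value) = entry xs y ys in s≤s bound , value

OfParity : Bool → ℕ → Set
OfParity false = EvenN
OfParity true  = OddN

parity-pred : ∀ b {i} → OfParity b (suc i) → OfParity (not b) i
parity-pred false (evS o) = o
parity-pred true  (odS e) = e

-- In a zigzag entered by a move of direction u, the i-th move inside xs is an
-- ascent exactly when i has parity u.  For u = false this is the shape of Alternating.
zigzag-moves : ∀ {u a} xs → Zigzag u a xs → ∀ i → suc i < length xs →
  (OfParity u i → nth xs i < nth xs (suc i)) × (OfParity (not u) i → nth xs (suc i) < nth xs i)
zigzag-moves []           _ _ ()
zigzag-moves (x ∷ [])     _ _ (s≤s ())
zigzag-moves {false} (x ∷ y ∷ ys) (_ , s , _) zero _ = (λ _ → s) , λ ()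
zigzag-moves {true}  (x ∷ y ∷ ys) (_ , s , _) zero _ = (λ ()) , λ _ → s
zigzag-moves {u} (x ∷ y ∷ ys) (_ , z) (suc i) (s≤s h) =
  let (ascent , descent) = zigzag-moves (y ∷ ys) z i h
  in (λ o → ascent (parity-pred u o)) , λ o → descent (parity-pred (not u) o)

-- odd q: position q is odd, i.e. an alternating permutation enters it by an ascent.
odd : ℕ → Bool
odd zero    = false
odd (suc n) = not (odd n)

parity : ∀ n → OfParity (odd n) n
parity zero = ev0
parity (suc n) with odd n | parity n
... | false | e = odS e
... | true  | o = evS o

alternating-move : ∀ {n} {w : Permutation′ n} → Alternating w →
  ∀ {q} → suc q < n → Step (not (odd q)) (val w q) (val w (suc q))
alternating-move alt {q} h with odd q | parity q
... | false | e = proj₁ (alt q h) e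
... | true  | o = proj₂ (alt q h) o

val-at : ∀ {k} (p : Permutation′ k) {j} (h : j < k) → val p j ≡ toℕ (p ⟨$⟩ʳ fromℕ< h)
val-at {k} p {j} h with j <? k
... | yes _  = refl
... | no j≮k = ⊥-elim (j≮k h)

val-toℕ : ∀ {k} (p : Permutation′ k) (a : Fin k) → val p (toℕ a) ≡ toℕ (p ⟨$⟩ʳ a)
val-toℕ p a = trans (val-at p (Fin.toℕ<n a)) (cong (λ c → toℕ (p ⟨$⟩ʳ c)) (Fin.fromℕ<-toℕ a _))

val< : ∀ {k} (p : Permutation′ k) {j} → j < k → val p j < k
val< p h rewrite val-at p h = Fin.toℕ<n _

perm-injective : ∀ {k} (p : Permutation′ k) {a b} → toℕ (p ⟨$⟩ʳ a) ≡ toℕ (p ⟨$⟩ʳ b) → a ≡ b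
perm-injective p {a} {b} e =
  trans (sym (inverseˡ p)) (trans (cong (p ⟨$⟩ˡ_) (Fin.toℕ-injective e)) (inverseˡ p))

val-injective : ∀ {k} (p : Permutation′ k) {i j} (hi : i < k) (hj : j < k) → val p i ≡ val p j → i ≡ j
val-injective p {i} {j} hi hj e = begin
    i                  ≡⟨ sym (Fin.toℕ-fromℕ< hi) ⟩
    toℕ (fromℕ< hi)    ≡⟨ cong toℕ (perm-injective p (trans (sym (val-at p hi)) (trans e (val-at p hj)))) ⟩
    toℕ (fromℕ< hj)    ≡⟨ Fin.toℕ-fromℕ< hj ⟩
    j                  ∎
  where open ≡-Reasoning

-- An injective endomap of Fin n is onto: a missed value y would let us squeeze
-- Fin n injectively into Fin (n - 1).
injective⇒surjective : ∀ {n} (h : Fin n → Fin n) → Injective _≡_ _≡_ h →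
  ∀ y → Σ (Fin n) λ x → h x ≡ y
injective⇒surjective {suc n} h h-injective y with Fin.any? (λ x → h x Fin.≟ y)
... | yes hit  = hit
... | no  miss = ⊥-elim (1+n≰n (Fin.injective⇒≤ squeeze-injective))
  where
  squeeze : Fin (suc n) → Fin n
  squeeze x = punchOut {i = y} {j = h x} (λ e → miss (x , sym e))
  squeeze-injective : Injective _≡_ _≡_ squeeze
  squeeze-injective e = h-injective (Fin.punchOut-injective {i = y} _ _ e)

injective⇒permutation : ∀ {n} (h : Fin n → Fin n) → Injective _≡_ _≡_ h →
  Σ (Permutation′ n) λ π → ∀ c → π ⟨$⟩ʳ c ≡ h c
injective⇒permutation h h-injective =
  permutation h (λ y → proj₁ (onto y)) (λ y → proj₂ (onto y)) (λ x → h-injective (proj₂ (onto (h x)))) ,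
  λ _ → refl
  where onto = injective⇒surjective h h-injective

module Ranking {n} (key : Fin n → ℕ) (key-injective : Injective _≡_ _≡_ key) where

  below : Fin n → Subset n
  below c = tabulate (λ d → key d <ᵇ key c)

  ∈-below⁻ : ∀ {c d} → d ∈ below c → key d < key c
  ∈-below⁻ {c} {d} d∈ = <ᵇ⇒< (key d) (key c) (Equivalence.from T-≡
    (trans (sym (lookup∘tabulate (λ x → key x <ᵇ key c) d)) ([]=⇒lookup d∈)))

  ∈-below⁺ : ∀ {c d} → key d < key c → d ∈ below c
  ∈-below⁺ {c} {d} lt = lookup⇒[]= d _
    (trans (lookup∘tabulate (λ x → key x <ᵇ key c) d) (Equivalence.to T-≡ (<⇒<ᵇ lt)))

  rank : Fin n → ℕ
  rank c = ∣ below c ∣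

  -- c itself is never below c, so the rank fits in Fin n
  rank< : ∀ c → rank c < n
  rank< c = subst (rank c <_) (∣⊤∣≡n n)
    (p⊂q⇒∣p∣<∣q∣ ((λ _ → ∈⊤) , c , ∈⊤ , λ c∈ → <-irrefl refl (∈-below⁻ c∈)))

  -- a larger key has strictly more keys below it (c itself, at least)
  rank-mono : ∀ {c d} → key c < key d → rank c < rank d
  rank-mono {c} {d} lt = p⊂q⇒∣p∣<∣q∣
    ((λ x∈ → ∈-below⁺ (<-trans (∈-below⁻ x∈) lt)) , c , ∈-below⁺ lt , λ c∈ → <-irrefl refl (∈-below⁻ c∈))

  rank-injective : ∀ {c d} → rank c ≡ rank d → c ≡ d
  rank-injective {c} {d} e with <-cmp (key c) (key d)
  ... | tri< lt _ _ = ⊥-elim (<-irrefl e (rank-mono lt))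
  ... | tri≈ _ eq _ = key-injective eq
  ... | tri> _ _ gt = ⊥-elim (<-irrefl (sym e) (rank-mono gt))

rank-permutation : ∀ {n} (key : Fin n → ℕ) → Injective _≡_ _≡_ key →
  Σ (Permutation′ n) λ π → ∀ {c d} → key c < key d → toℕ (π ⟨$⟩ʳ c) < toℕ (π ⟨$⟩ʳ d)
rank-permutation key key-injective = π , λ {c} {d} lt →
  subst₂ _<_ (sym (trans (cong toℕ (acts c)) (Fin.toℕ-fromℕ< _)))
             (sym (trans (cong toℕ (acts d)) (Fin.toℕ-fromℕ< _))) (rank-mono lt)
  where
  open Ranking key key-injective
  slot : Fin _ → Fin _
  slot c = fromℕ< (rank< c)
  slot-injective : Injective _≡_ _≡_ slot
  slot-injective e = rank-injective (trans (sym (Fin.toℕ-fromℕ< _)) (trans (cong toℕ e) (Fin.toℕ-fromℕ< _)))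
  π : Permutation′ _
  π = proj₁ (injective⇒permutation slot slot-injective)
  acts : ∀ c → π ⟨$⟩ʳ c ≡ slot c
  acts = proj₂ (injective⇒permutation slot slot-injective)

-- Two-digit comparison in base n: the high digit decides.
high-digit-< : ∀ {n a b r s} → r < n → a < b → n * a + r < n * b + s
high-digit-< {n} {a} {b} {r} {s} r<n a<b = begin-strict
  n * a + r  <⟨ +-monoʳ-< (n * a) r<n ⟩
  n * a + n  ≡⟨ +-comm (n * a) n ⟩
  n + n * a  ≡⟨ sym (*-suc n a) ⟩
  n * suc a  ≤⟨ *-monoʳ-≤ n a<b ⟩
  n * b      ≤⟨ m≤m+n (n * b) s ⟩
  n * b + s  ∎
  where open ≤-Reasoning

-- Standardisation: any sequence g of length n is weakly order-isomorphic to a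
-- permutation (ties broken by position, encoded as the key n·g(i) + i).
standardize : ∀ n (g : ℕ → ℕ) → Σ (Permutation′ n) λ w → ∀ {i j} → i < n → j < n →
  (g i < g j → val w i < val w j) × (val w i < val w j → g i ≤ g j)
standardize n g = w , λ hi hj → forward hi hj , λ lt → ≮⇒≥ λ gt → <-asym lt (forward hj hi gt)
  where
  key : Fin n → ℕ
  key c = n * g (toℕ c) + toℕ c
  key-injective : Injective _≡_ _≡_ key
  key-injective {c} {d} e with <-cmp (g (toℕ c)) (g (toℕ d))
  ... | tri< lt _ _ = ⊥-elim (<-irrefl e (high-digit-< (Fin.toℕ<n c) lt))
  ... | tri> _ _ gt = ⊥-elim (<-irrefl (sym e) (high-digit-< (Fin.toℕ<n d) gt))
  ... | tri≈ _ eq _ = Fin.toℕ-injective (+-cancelˡ-≡ (n * g (toℕ c)) _ _ (trans e (cong (λ x → n * x + toℕ d) (sym eq))))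
  ranked : Σ (Permutation′ n) λ π → ∀ {c d} → key c < key d → toℕ (π ⟨$⟩ʳ c) < toℕ (π ⟨$⟩ʳ d)
  ranked = rank-permutation key key-injective
  w : Permutation′ n
  w = proj₁ ranked
  forward : ∀ {i j} (hi : i < n) (hj : j < n) → g i < g j → val w i < val w j
  forward {i} {j} hi hj lt = subst₂ _<_ (sym (val-at w hi)) (sym (val-at w hj))
    (proj₂ ranked (high-digit-< {n} (Fin.toℕ<n (fromℕ< hi))
      (subst₂ _<_ (cong g (sym (Fin.toℕ-fromℕ< hi))) (cong g (sym (Fin.toℕ-fromℕ< hj))) lt)))

bit : Bool → ℕ
bit true  = 1
bit false = 0

bit≤1 : ∀ b → bit b ≤ 1
bit≤1 true  = ≤-refl
bit≤1 false = z≤n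

does-≡ : ∀ {A : Set} (A? : Dec A) u v → A ⇔ (u ≡ v) → does A? ≡ not (u xor v)
does-≡ (yes a) u v A⇔ with Equivalence.to A⇔ a
... | refl = sym (cong not (xor-same u))
does-≡ (no ¬a) true  true  A⇔ = ⊥-elim (¬a (Equivalence.from A⇔ refl))
does-≡ (no ¬a) false false A⇔ = ⊥-elim (¬a (Equivalence.from A⇔ refl))
does-≡ (no _)  true  false _  = refl
does-≡ (no _)  false true  _  = refl

decide-≤ : ∀ {m n} → T (m ≤ᵇ n) → m ≤ n
decide-≤ = ≤ᵇ⇒≤ _ _

-- Position 0 is never entered by an ascent, so the invariant below starts correctly.
odd≤ : ∀ a → bit (odd a) ≤ a
odd≤ zero    = z≤n
odd≤ (suc a) = ≤-trans (bit≤1 _) (s≤s z≤n)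

-- Let p enter two consecutive entries in directions u and u', and let
-- them be matched at positions a < d + suc a of an alternating w (which enters position
-- q by an ascent iff q is odd).  The d + 1 steps between them pay for a doubling at the
-- first entry and a mismatch at the second, up to a mismatch already present at the first.
-- For d = 0 the move of w is the move of p, which is what the hypothesis records.
gap : ∀ u u' a d → (d ≡ 0 → u' ≡ not (odd a)) →
  suc (bit (not (u xor u')) + bit (u' xor odd (d + suc a))) ≤ suc d + bit (u xor odd a)
gap u u' a zero adjacent rewrite adjacent refl with odd a | u
... | false | false = decide-≤ tt
... | false | true  = decide-≤ tt
... | true  | false = decide-≤ tt
... | true  | true  = decide-≤ tt
gap u u' a (suc zero) _ with odd a | u | u'
... | false | false | false = decide-≤ tt
... | false | false | true  = decide-≤ tt
... | false | true  | false = decide-≤ tt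
... | false | true  | true  = decide-≤ tt
... | true  | false | false = decide-≤ tt
... | true  | false | true  = decide-≤ tt
... | true  | true  | false = decide-≤ tt
... | true  | true  | true  = decide-≤ tt
gap u u' a (suc (suc d)) _ =
  ≤-trans (s≤s (+-mono-≤ (bit≤1 (not (u xor u'))) (bit≤1 (u' xor odd (suc (suc d) + suc a)))))
          (≤-trans (s≤s (s≤s (s≤s z≤n))) (m≤m+n (suc (suc (suc d))) (bit (u xor odd a))))

-- The lower-bound invariant advances from an entry matched at a to the next one at b.
advance : ∀ {x u u' a b} → x + bit (u xor odd a) ≤ a → a < b → (b ≡ suc a → u' ≡ not (odd a)) →
  suc x + bit (not (u xor u')) + bit (u' xor odd b) ≤ b
advance {x} {u} {u'} {a} {b} invariant a<b adjacent =
  subst (λ c → suc x + δ + bit (u' xor odd c) ≤ c) b≡ (begin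
  suc x + δ + bit (u' xor odd (d + suc a))     ≡⟨ shift x δ _ ⟩
  x + suc (δ + bit (u' xor odd (d + suc a)))   ≤⟨ +-monoʳ-≤ x (gap u u' a d λ d≡0 →
                                                    adjacent (trans (sym b≡) (cong (_+ suc a) d≡0))) ⟩
  x + (suc d + m)                              ≡⟨ swap x d m ⟩
  x + m + suc d                                ≤⟨ +-monoˡ-≤ (suc d) invariant ⟩
  a + suc d                                    ≡⟨ exchange a d ⟩
  d + suc a                                    ∎)
  where
  open ≤-Reasoning
  δ m d : ℕ
  δ = bit (not (u xor u'))
  m = bit (u xor odd a)
  d = b ∸ suc a
  b≡ : d + suc a ≡ b
  b≡ = m∸n+n≡m a<b
  shift : ∀ x y z → suc x + y + z ≡ x + suc (y + z)
  shift = solve-∀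
  swap : ∀ x y z → x + (suc y + z) ≡ x + z + suc y
  swap = solve-∀
  exchange : ∀ x y → x + suc y ≡ y + suc x
  exchange = solve-∀

module Pattern {k} (p : Permutation′ k) where

  -- up j: p reaches p_j by an ascent (never for j = 0, as p_{-1} = ∞)
  up : ℕ → Bool
  up zero    = false
  up (suc j) = val p j <ᵇ val p (suc j)

  step-up : ∀ {j} → suc j < k → Step (up (suc j)) (val p j) (val p (suc j))
  step-up {j} h = step-<ᵇ λ e → 1+n≢n (sym (val-injective p (<-trans (n<1+n j) h) h e))

  doubling⇔ : ∀ {j} → suc j < k → DoublingAt p j ⇔ (up j ≡ up (suc j))
  doubling⇔ {zero} h = mk⇔ (λ d → sym (step-unique {v = false} (step-up h) d))
                           (λ e → subst (λ u → Step u (val p 0) (val p 1)) (sym e) (step-up h))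
  doubling⇔ {suc i} h = mk⇔ monotone⇒same (λ e → same-direction (up (suc i)) s₁
                                                  (subst (λ u → Step u (val p (suc i)) (val p (suc (suc i)))) (sym e) s₂))
    where
    s₁ : Step (up (suc i)) (val p i) (val p (suc i))
    s₁ = step-up (<-trans (n<1+n (suc i)) h)
    s₂ : Step (up (suc (suc i))) (val p (suc i)) (val p (suc (suc i)))
    s₂ = step-up h
    monotone⇒same : DoublingAt p (suc i) → up (suc i) ≡ up (suc (suc i))
    monotone⇒same (inj₁ (a , b)) = trans (step-unique {v = false} s₁ a) (sym (step-unique {v = false} s₂ b))
    monotone⇒same (inj₂ (a , b)) = trans (step-unique {v = true} s₁ a) (sym (step-unique {v = true} s₂ b))

  doubling-bit : ∀ {j} → suc j < k → does (doublingAt? p j) ≡ not (up j xor up (suc j))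
  doubling-bit {j} h = does-≡ (doublingAt? p j) (up j) (up (suc j)) (doubling⇔ h)

  doublings : ℕ → ℕ
  doublings j = length (filter (doublingAt? p) (upTo j))

  doublings-suc : ∀ j → doublings (suc j) ≡ doublings j + bit (does (doublingAt? p j))
  doublings-suc j = begin
    length (filter P? (upTo (suc j)))               ≡⟨ cong (length ∘ filter P?) (sym (upTo-∷ʳ j)) ⟩
    length (filter P? (upTo j ++ [ j ]))            ≡⟨ cong length (filter-++ P? (upTo j) [ j ]) ⟩
    length (filter P? (upTo j) ++ filter P? [ j ])  ≡⟨ length-++ (filter P? (upTo j)) ⟩
    doublings j + length (filter P? [ j ])          ≡⟨ cong (doublings j +_) singleton ⟩
    doublings j + bit (does (P? j))                 ∎
    where
    open ≡-Reasoning
    P? : (i : ℕ) → Dec (DoublingAt p i)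
    P? = doublingAt? p
    singleton : length (filter P? [ j ]) ≡ bit (does (P? j))
    singleton with does (P? j)
    ... | true  = refl
    ... | false = refl

  doublings-mono : ∀ {i j} → i ≤ j → doublings i ≤ doublings j
  doublings-mono {i} {zero}  z≤n = ≤-refl
  doublings-mono {i} {suc j} i≤1+j with m≤n⇒m<n∨m≡n i≤1+j
  ... | inj₂ refl = ≤-refl
  ... | inj₁ i<1+j = ≤-trans (doublings-mono (s≤s⁻¹ i<1+j))
                             (≤-trans (m≤m+n _ _) (≤-reflexive (sym (doublings-suc j))))

-- Scaling by 3 leaves room for a new value on either side of every entry.
step-scaled : ∀ {u a b r} → r < 3 → Step u a b → Step u (3 * a + r) (3 * b + 1)
step-scaled {true}          r<3 a<b = high-digit-< {3} r<3 a<b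
step-scaled {false} {r = r} _   b<a = high-digit-< {3} {s = r} (s≤s (s≤s z≤n)) b<a

-- The entry 3·v + 1 and the offset position 3·v + dip u next to it.
dip : Bool → ℕ
dip true  = 0
dip false = 2

dip<3 : ∀ u → dip u < 3
dip<3 true  = s≤s z≤n
dip<3 false = ≤-refl

into-dip : ∀ u v → Step (not u) (3 * v + 1) (3 * v + dip u)
into-dip true  v = +-monoʳ-< (3 * v) (s≤s z≤n)
into-dip false v = +-monoʳ-< (3 * v) (n<1+n 1)

module Construction {k'} (p : Permutation′ (suc k')) where
  open Pattern p

  node : ℕ → ℕ
  node j = 3 * val p j + 1

  -- a doubling entry is followed by a partner just below it (if p ascends through
  -- p_j) or just above it (if p descends), so that w turns around between them
  partner : ℕ → List ℕ
  partner j = if does (doublingAt? p j) then [ 3 * val p j + dip (up j) ] else []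

  length-partner : ∀ j → length (partner j) ≡ bit (does (doublingAt? p j))
  length-partner j with does (doublingAt? p j)
  ... | true  = refl
  ... | false = refl

  block : ℕ → List ℕ
  block j = node j ∷ partner j

  wordFrom : ℕ → ℕ → List ℕ
  wordFrom j zero    = node j ∷ []
  wordFrom j (suc m) = block j ++ wordFrom (suc j) m

  word : List ℕ
  word = wordFrom 0 k'

  wordFrom-zigzag : ∀ j m → j + m ≡ k' → ∀ {a} → Step (up j) a (node j) → Zigzag (up j) a (wordFrom j m)
  wordFrom-zigzag j zero    _ enter = enter , tt
  wordFrom-zigzag j (suc m) e enter = enter , continue
    where
    h : suc j < suc k'
    h = s≤s (subst (suc j ≤_) e (≤-trans (s≤s (m≤m+n j m)) (≤-reflexive (sym (+-suc j m)))))
    rest : ∀ {r} → r < 3 → Zigzag (up (suc j)) (3 * val p j + r) (wordFrom (suc j) m)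
    rest r<3 = wordFrom-zigzag (suc j) m (trans (sym (+-suc j m)) e) (step-scaled r<3 (step-up h))
    continue : Zigzag (not (up j)) (node j) (partner j ++ wordFrom (suc j) m)
    continue with doublingAt? p j
    ... | yes d = into-dip (up j) (val p j) ,
                  subst (λ u → Zigzag u (3 * val p j + dip (up j)) (wordFrom (suc j) m))
                        (sym (trans (not-involutive (up j)) (Equivalence.to (doubling⇔ h) d)))
                        (rest (dip<3 (up j)))
    ... | no ¬d = subst (λ u → Zigzag u (node j) (wordFrom (suc j) m))
                        (¬-not λ e → ¬d (Equivalence.from (doubling⇔ h) (sym e)))
                        (rest (s≤s (s≤s z≤n)))

  word-zigzag : Zigzag false (3 * suc k' + 1) word
  word-zigzag = wordFrom-zigzag 0 k' refl (step-scaled {false} (s≤s (s≤s z≤n)) (val< p (s≤s z≤n)))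

  blocks : ℕ → List ℕ
  blocks zero    = []
  blocks (suc j) = blocks j ++ block j

  position : ℕ → ℕ
  position j = length (blocks j)

  word-split : ∀ i m → wordFrom 0 (i + m) ≡ blocks i ++ wordFrom i m
  word-split zero    m = refl
  word-split (suc i) m = begin
    wordFrom 0 (suc i + m)                        ≡⟨ cong (wordFrom 0) (sym (+-suc i m)) ⟩
    wordFrom 0 (i + suc m)                        ≡⟨ word-split i (suc m) ⟩
    blocks i ++ (block i ++ wordFrom (suc i) m)   ≡⟨ sym (++-assoc (blocks i) (block i) _) ⟩
    blocks (suc i) ++ wordFrom (suc i) m          ∎
    where open ≡-Reasoning

  position-formula : ∀ j → position j ≡ j + doublings j
  position-formula zero    = refl
  position-formula (suc j) = begin
    length (blocks j ++ block j)                            ≡⟨ length-++ (blocks j) ⟩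
    position j + suc (length (partner j))                   ≡⟨ cong₂ (λ x b → x + suc b) (position-formula j) (length-partner j) ⟩
    j + doublings j + suc (bit (does (doublingAt? p j)))   ≡⟨ regroup j (doublings j) _ ⟩
    suc j + (doublings j + bit (does (doublingAt? p j)))   ≡⟨ cong (suc j +_) (sym (doublings-suc j)) ⟩
    suc j + doublings (suc j)                               ∎
    where
    open ≡-Reasoning
    regroup : ∀ x d b → x + d + suc b ≡ suc x + (d + b)
    regroup = solve-∀

  position-mono : ∀ {i j} → i < j → position i < position j
  position-mono {i} {j} i<j rewrite position-formula i | position-formula j =
    +-mono-<-≤ i<j (doublings-mono (<⇒≤ i<j))

  starts-with-node : ∀ j m → Σ (List ℕ) λ ys → wordFrom j m ≡ node j ∷ ys
  starts-with-node j zero    = [] , refl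
  starts-with-node j (suc m) = partner j ++ wordFrom (suc j) m , refl

  node-at : ∀ {j} → j ≤ k' → position j < length word × nth word (position j) ≡ node j
  node-at {j} j≤k' =
    subst (λ xs → position j < length xs × nth xs (position j) ≡ node j) (sym word≡) (entry (blocks j) (node j) ys)
    where
    ys : List ℕ
    ys = proj₁ (starts-with-node j (k' ∸ j))
    word≡ : word ≡ blocks j ++ node j ∷ ys
    word≡ = trans (cong (wordFrom 0) (sym (m+[n∸m]≡n j≤k')))
                  (trans (word-split j (k' ∸ j)) (cong (blocks j ++_) (proj₂ (starts-with-node j (k' ∸ j)))))

  length-word : length word ≡ suc k' + doublings k'
  length-word = begin
    length (wordFrom 0 k')             ≡⟨ cong (length ∘ wordFrom 0) (sym (+-identityʳ k')) ⟩
    length (wordFrom 0 (k' + 0))       ≡⟨ cong length (word-split k' 0) ⟩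
    length (blocks k' ++ node k' ∷ []) ≡⟨ length-++ (blocks k') ⟩
    position k' + 1                    ≡⟨ +-comm (position k') 1 ⟩
    suc (position k')                  ≡⟨ cong suc (position-formula k') ⟩
    suc k' + doublings k'              ∎
    where open ≡-Reasoning

  realise : ∀ n → length word ≡ n → Σ (Permutation′ n) λ w → Alternating w × Contains w p
  realise _ refl = w , alternating , f , increasing , λ a b → mk⇔ (forward a b) (backward a b)
    where
    standard : Σ (Permutation′ (length word)) λ w → ∀ {i j} → i < length word → j < length word →
      (nth word i < nth word j → val w i < val w j) × (val w i < val w j → nth word i ≤ nth word j)
    standard = standardize (length word) (nth word)
    w : Permutation′ (length word)
    w = proj₁ standard
    order : ∀ {i j} → i < length word → j < length word →
      (nth word i < nth word j → val w i < val w j) × (val w i < val w j → nth word i ≤ nth word j)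
    order = proj₂ standard

    alternating : Alternating w
    alternating i h =
      let (ascent , descent) = zigzag-moves word word-zigzag i h
          hi = <-trans (n<1+n i) h
      in (λ e → proj₁ (order hi h) (ascent e)) , λ o → proj₁ (order h hi) (descent o)

    placed : (a : Fin (suc k')) → position (toℕ a) < length word × nth word (position (toℕ a)) ≡ node (toℕ a)
    placed a = node-at (s≤s⁻¹ (Fin.toℕ<n a))
    f : Fin (suc k') → Fin (length word)
    f a = fromℕ< (proj₁ (placed a))

    increasing : ∀ a b → toℕ a < toℕ b → toℕ (f a) < toℕ (f b)
    increasing a b lt = subst₂ _<_ (sym (Fin.toℕ-fromℕ< _)) (sym (Fin.toℕ-fromℕ< _)) (position-mono lt)

    image : ∀ a → toℕ (w ⟨$⟩ʳ f a) ≡ val w (position (toℕ a))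
    image a = sym (val-at w (proj₁ (placed a)))
    entry-value : ∀ a → nth word (position (toℕ a)) ≡ 3 * toℕ (p ⟨$⟩ʳ a) + 1
    entry-value a = trans (proj₂ (placed a)) (cong (λ v → 3 * v + 1) (val-toℕ p a))
    order-at : ∀ a b → (nth word (position (toℕ a)) < nth word (position (toℕ b)) → toℕ (w ⟨$⟩ʳ f a) < toℕ (w ⟨$⟩ʳ f b)) ×
                       (toℕ (w ⟨$⟩ʳ f a) < toℕ (w ⟨$⟩ʳ f b) → nth word (position (toℕ a)) ≤ nth word (position (toℕ b)))
    order-at a b = let (up⇒ , up⇐) = order (proj₁ (placed a)) (proj₁ (placed b)) in
      (λ lt → subst₂ _<_ (sym (image a)) (sym (image b)) (up⇒ lt)) , λ lt → up⇐ (subst₂ _<_ (image a) (image b) lt)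

    forward : ∀ a b → toℕ (p ⟨$⟩ʳ a) < toℕ (p ⟨$⟩ʳ b) → toℕ (w ⟨$⟩ʳ f a) < toℕ (w ⟨$⟩ʳ f b)
    forward a b lt = proj₁ (order-at a b)
      (subst₂ _<_ (sym (entry-value a)) (sym (entry-value b)) (high-digit-< {3} (s≤s (s≤s z≤n)) lt))

    backward : ∀ a b → toℕ (w ⟨$⟩ʳ f a) < toℕ (w ⟨$⟩ʳ f b) → toℕ (p ⟨$⟩ʳ a) < toℕ (p ⟨$⟩ʳ b)
    backward a b lt = ≤∧≢⇒< (≮⇒≥ λ gt → <⇒≱ (high-digit-< {3} (s≤s (s≤s z≤n)) gt) le)
                            (λ e → <-irrefl (cong (λ c → toℕ (w ⟨$⟩ʳ f c)) (perm-injective p e)) lt)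
      where
      le : 3 * toℕ (p ⟨$⟩ʳ a) + 1 ≤ 3 * toℕ (p ⟨$⟩ʳ b) + 1
      le = subst₂ _≤_ (entry-value a) (entry-value b) (proj₂ (order-at a b) lt)

  existence : Σ (Permutation′ (suc k' + doublingNumber p)) λ w → Alternating w × Contains w p
  existence = realise _ length-word

module LowerBound {k'} (p : Permutation′ (suc k')) {n} (w : Permutation′ n)
                  (alternating : Alternating w) (contains : Contains w p) where
  open Pattern p

  f : Fin (suc k') → Fin n
  f = proj₁ contains
  f-increasing : ∀ i j → toℕ i < toℕ j → toℕ (f i) < toℕ (f j)
  f-increasing = proj₁ (proj₂ contains)
  f-iso : ∀ i j → (toℕ (p ⟨$⟩ʳ i) < toℕ (p ⟨$⟩ʳ j)) ⇔ (toℕ (w ⟨$⟩ʳ f i) < toℕ (w ⟨$⟩ʳ f j))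
  f-iso = proj₂ (proj₂ contains)

  F : ℕ → ℕ
  F j with j <? suc k'
  ... | yes h = toℕ (f (fromℕ< h))
  ... | no  _ = 0

  F-at : ∀ {j} (h : j < suc k') → F j ≡ toℕ (f (fromℕ< h))
  F-at {j} h with j <? suc k'
  ... | yes _  = refl
  ... | no j≮k = ⊥-elim (j≮k h)

  F-bound : ∀ {j} → j < suc k' → F j < n
  F-bound h rewrite F-at h = Fin.toℕ<n _

  F-increasing : ∀ {j} → suc j < suc k' → F j < F (suc j)
  F-increasing {j} h rewrite F-at (<-trans (n<1+n j) h) | F-at h =
    f-increasing _ _ (subst₂ _<_ (sym (Fin.toℕ-fromℕ< _)) (sym (Fin.toℕ-fromℕ< h)) (n<1+n j))

  matched : ∀ {j} (h : j < suc k') → val w (F j) ≡ toℕ (w ⟨$⟩ʳ f (fromℕ< h))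
  matched h = trans (cong (val w) (F-at h)) (val-toℕ w _)

  preserve : ∀ u {a b} → Step u (toℕ (p ⟨$⟩ʳ a)) (toℕ (p ⟨$⟩ʳ b)) → Step u (toℕ (w ⟨$⟩ʳ f a)) (toℕ (w ⟨$⟩ʳ f b))
  preserve true  {a} {b} = Equivalence.to (f-iso a b)
  preserve false {a} {b} = Equivalence.to (f-iso b a)

  F-move : ∀ {j} → suc j < suc k' → Step (up (suc j)) (val w (F j)) (val w (F (suc j)))
  F-move {j} h = subst₂ (Step (up (suc j))) (sym (matched hj)) (sym (matched h))
    (preserve (up (suc j)) (subst₂ (Step (up (suc j))) (val-at p hj) (val-at p h) (step-up h)))
    where hj = <-trans (n<1+n j) h

  adjacent-direction : ∀ {j} → suc j < suc k' → F (suc j) ≡ suc (F j) → up (suc j) ≡ not (odd (F j))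
  adjacent-direction {j} h e = step-unique (F-move h)
    (subst (λ q → Step (not (odd (F j))) (val w (F j)) (val w q)) (sym e)
           (alternating-move alternating (subst (_< n) e (F-bound h))))

  -- mismatch j: w enters F j in the direction opposite to that in which p enters p_j
  mismatch : ℕ → ℕ
  mismatch j = bit (up j xor odd (F j))

  invariant : ∀ j → j < suc k' → j + doublings j + mismatch j ≤ F j
  invariant zero    _ = odd≤ (F 0)
  invariant (suc j) h = begin
    suc j + doublings (suc j) + mismatch (suc j)
      ≡⟨ cong (λ t → suc j + t + mismatch (suc j)) (doublings-suc j) ⟩
    suc j + (doublings j + bit (does (doublingAt? p j))) + mismatch (suc j)
      ≡⟨ cong (λ t → t + mismatch (suc j)) (sym (+-assoc (suc j) (doublings j) _)) ⟩
    suc (j + doublings j) + bit (does (doublingAt? p j)) + mismatch (suc j)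
      ≡⟨ cong (λ b → suc (j + doublings j) + bit b + mismatch (suc j)) (doubling-bit h) ⟩
    suc (j + doublings j) + bit (not (up j xor up (suc j))) + mismatch (suc j)
      ≤⟨ advance {x = j + doublings j} {u = up j} (invariant j (<-trans (n<1+n j) h)) (F-increasing h) (adjacent-direction h) ⟩
    F (suc j) ∎
    where open ≤-Reasoning

  lower-bound : suc k' + doublingNumber p ≤ n
  lower-bound = ≤-trans (s≤s (≤-trans (m≤m+n _ (mismatch k')) (invariant k' ≤-refl))) (F-bound ≤-refl)

theorem5p1 : (k : ℕ) (p : Permutation′ k) →
    (Σ (Permutation′ (k + doublingNumber p)) λ w → Alternating w × Contains w p) ×
    (∀ (n : ℕ) (w : Permutation′ n) → Alternating w → Contains w p → k + doublingNumber p ≤ n)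
theorem5p1 zero     p = (Perm.id , (λ _ ()) , (λ ()) , (λ ()) , λ ()) , λ _ _ _ _ → z≤n
theorem5p1 (suc k') p = Construction.existence p , λ _ w alternating contains →
  LowerBound.lower-bound p w alternating contains
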